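{- Let $S$ be a flat counter system, $P=p_1l_1^+\cdots p_kl_k^\omega$ a path schema of $S$ and $\varphi\in\mathrm{PLTL}[\emptyset]$. For all runs $\rho,\rho'$ respecting $P$ such that $\rho\equiv_{2\,\mathrm{td}(\varphi)+5}\rho'$, we have $\rho,0\models\varphi$ iff $\rho',0\models\varphi$.
   Context: Counter systems $S=\langle Q,\mathtt{C}_n,\Delta,\mathbf{l}\rangle$ have finite control states $Q$, labelling $\mathbf{l}:Q\to 2^{\mathrm{AT}}$ and finitely many transitions $(q,\mathtt{g},\vec u,q')$ with guards $\mathtt{g}$ on counters and updates $\vec u\in\mathbb{Z}^n$; configurations are in $Q\times\mathbb{N}^n$ and a run is an infinite sequence of configurations connected by transitions whose guards hold and with counters updated by $\vec u$; flat means each state lies on at most one simple cycle. A loop is a nonempty transition sequence without repeated transitions returning to its first state; a path schema $P=p_1l_1^+\cdots p_kl_k^\omega$ has $l_i$ loops and $p_1l_1\cdots p_kl_k$ a connected transition sequence. A run $\rho$ respects $P$ if its transition word equals $p_1l_1^{n_1}\cdots p_{k-1}l_{k-1}^{n_{k-1}}p_kl_k^\omega$ for some $n_1,\dots,n_{k-1}\ge1$; then $\mathrm{iter}_P(\rho)=(n_1,\dots,n_{k-1})$. For $\alpha\ge0$, $\rho\equiv_\alpha\rho'$ iff $\min(\mathrm{iter}_P(\rho)[i],\alpha)=\min(\mathrm{iter}_P(\rho')[i],\alpha)$ for all $i\in[1,k-1]$. $\mathrm{PLTL}[\emptyset]$ is LTL with past ($\mathtt{X},\mathtt{U},\mathtt{X}^{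 -1},\mathtt{S}$) over propositions, with $p$ true at position $i$ of a run iff $p\in\mathbf{l}(q_i)$; $\mathrm{td}(\varphi)$ is the maximal nesting depth of temporal operators in $\varphi$. -}

module Defs where

open import Data.Nat using (ℕ; zero; suc; _≤_; _<_; _⊓_; _⊔_; _%_)
open import Data.Integer as ℤ using (ℤ; +_; 0ℤ)
open import Data.Fin using (Fin)
open import Data.Vec as Vec using (Vec; []; _∷_; lookup; zipWith)
open import Data.List as List using (List; []; _∷_; _++_; length; concat; replicate)
open import Data.List.Relation.Unary.Unique.Propositional using (Unique)
open import Data.Product using (Σ; ∃; _×_; _,_)
open import Data.Bool using (Bool; true)
open import Data.Unit using (⊤)
open import Data.Empty using (⊥)
open import Relation.Binary.PropositionalEquality using (_≡_)
open import Relation.Nullary using (¬_)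

data CmpRel : Set where
  eq le ge lt gt : CmpRel

data Guard (n : ℕ) : Set where
  atomG : Vec ℤ n → CmpRel → ℤ → Guard n
  negG  : Guard n → Guard n
  andG  : Guard n → Guard n → Guard n

linComb : ∀ {n} → Vec ℤ n → Vec ℕ n → ℤ
linComb []       []       = 0ℤ
linComb (a ∷ as) (x ∷ xs) = (a ℤ.* + x) ℤ.+ linComb as xs

⟦_⟧rel : CmpRel → ℤ → ℤ → Set
⟦ eq ⟧rel x y = x ≡ y
⟦ le ⟧rel x y = x ℤ.≤ y
⟦ ge ⟧rel x y = y ℤ.≤ x
⟦ lt ⟧rel x y = x ℤ.< y
⟦ gt ⟧rel x y = y ℤ.< x

⟦_⟧g : ∀ {n} → Guard n → Vec ℕ n → Set
⟦ atomG a r b ⟧g v = ⟦ r ⟧rel (linComb a v) b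
⟦ negG g ⟧g v      = ¬ ⟦ g ⟧g v
⟦ andG g h ⟧g v    = ⟦ g ⟧g v × ⟦ h ⟧g v

record Transition (nQ nC : ℕ) : Set where
  field
    src   : Fin nQ
    guard : Guard nC
    upd   : Vec ℤ nC
    tgt   : Fin nQ

record CounterSystem (AT : Set) : Set where
  field
    nQ  : ℕ
    nC  : ℕ
    nΔ  : ℕ
    Δ   : Fin nΔ → Transition nQ nC
    lab : Fin nQ → AT → Bool      -- l : Q → 2^AT (characteristic function)

data PLTL (AT : Set) : Set where
  atom  : AT → PLTL AT
  ¬'_   : PLTL AT → PLTL AT
  _∧'_  : PLTL AT → PLTL AT → PLTL AT
  X_    : PLTL AT → PLTL AT
  _U_   : PLTL AT → PLTL AT → PLTL AT
  X⁻¹_  : PLTL AT → PLTL AT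
  _S_   : PLTL AT → PLTL AT → PLTL AT

td : ∀ {AT} → PLTL AT → ℕ
td (atom p)  = 0
td (¬' φ)    = td φ
td (φ ∧' ψ)  = td φ ⊔ td ψ
td (X φ)     = suc (td φ)
td (φ U ψ)   = suc (td φ ⊔ td ψ)
td (X⁻¹ φ)   = suc (td φ)
td (φ S ψ)   = suc (td φ ⊔ td ψ)

_++ω_ : ∀ {A : Set} → List A → (ℕ → A) → ℕ → A
([] ++ω f) j            = f j
((x ∷ xs) ++ω f) zero    = x
((x ∷ xs) ++ω f) (suc j) = (xs ++ω f) j

nthD : ∀ {A : Set} → A → List A → ℕ → A
nthD d []       _       = d
nthD d (x ∷ xs) zero    = x
nthD d (x ∷ xs) (suc j) = nthD d xs j

cycleω : ∀ {A : Set} → A → List A → ℕ → A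
cycleω x xs j = nthD x (x ∷ xs) (j % suc (length xs))

module _ {AT : Set} (S : CounterSystem AT) where
  open CounterSystem S

  Tr : Set
  Tr = Fin nΔ

  srcT : Tr → Fin nQ
  srcT t = Transition.src (Δ t)

  tgtT : Tr → Fin nQ
  tgtT t = Transition.tgt (Δ t)

  Connected : List Tr → Set
  Connected []            = ⊤
  Connected (t ∷ [])      = ⊤
  Connected (t ∷ t' ∷ ts) = tgtT t ≡ srcT t' × Connected (t' ∷ ts)

  lastOf : Tr → List Tr → Tr
  lastOf t []        = t
  lastOf t (t' ∷ ts) = lastOf t' ts

  Closed : Tr → List Tr → Set
  Closed t ts = Connected (t ∷ ts) × tgtT (lastOf t ts) ≡ srcT t

  SimpleCycleAt : Fin nQ → List Tr → Set
  SimpleCycleAt q []       = ⊥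
  SimpleCycleAt q (t ∷ ts) = srcT t ≡ q × Closed t ts × Unique (List.map srcT (t ∷ ts))

  Flat : Set
  Flat = ∀ q c c' → SimpleCycleAt q c → SimpleCycleAt q c' → c ≡ c'

  Loop : List Tr → Set
  Loop []       = ⊥
  Loop (t ∷ ts) = Closed t ts × Unique (t ∷ ts)

  segsWord : ∀ {k} → Vec (List Tr × List Tr) k → List Tr
  segsWord []             = []
  segsWord ((p , l) ∷ ss) = p ++ l ++ segsWord ss

  -- P = p₁ l₁⁺ ⋯ p_{k-1} l_{k-1}⁺ p_k l_k^ω  with k = suc k'
  -- segs = (p₁,l₁) … (p_{k-1},l_{k-1});  l_k = lkHead ∷ lkTail
  record PathSchema : Set where
    field
      k'     : ℕ
      segs   : Vec (List Tr × List Tr) k'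
      pk     : List Tr
      lkHead : Tr
      lkTail : List Tr
      segLoops : ∀ i → Loop (Data.Product.proj₂ (lookup segs i))
      lastLoop : Loop (lkHead ∷ lkTail)
      connected : Connected (segsWord segs ++ pk ++ lkHead ∷ lkTail)

  iterWord : ∀ {k} → Vec (List Tr × List Tr) k → Vec ℕ k → List Tr
  iterWord []             []       = []
  iterWord ((p , l) ∷ ss) (n ∷ ns) = p ++ concat (replicate n l) ++ iterWord ss ns

  schemaWord : (P : PathSchema) → Vec ℕ (PathSchema.k' P) → ℕ → Tr
  schemaWord P ns =
    (iterWord segs ns ++ pk) ++ω cycleω lkHead lkTail
    where open PathSchema P

  record Run : Set where
    field
      st  : ℕ → Fin nQ
      val : ℕ → Vec ℕ nC
      tr  : ℕ → Tr
      src-ok   : ∀ i → srcT (tr i) ≡ st i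
      tgt-ok   : ∀ i → tgtT (tr i) ≡ st (suc i)
      guard-ok : ∀ i → ⟦ Transition.guard (Δ (tr i)) ⟧g (val i)
      upd-ok   : ∀ i → Vec.map +_ (val (suc i))
                        ≡ zipWith ℤ._+_ (Vec.map +_ (val i)) (Transition.upd (Δ (tr i)))

  -- ρ respects P with iter_P(ρ) = ns
  Respects : (P : PathSchema) → Run → Vec ℕ (PathSchema.k' P) → Set
  Respects P ρ ns = (∀ i → 1 ≤ lookup ns i) × (∀ j → Run.tr ρ j ≡ schemaWord P ns j)

  Sat : Run → ℕ → PLTL AT → Set
  Sat ρ i (atom p)      = lab (Run.st ρ i) p ≡ true
  Sat ρ i (¬' φ)        = ¬ Sat ρ i φ
  Sat ρ i (φ ∧' ψ)      = Sat ρ i φ × Sat ρ i ψ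
  Sat ρ i (X φ)         = Sat ρ (suc i) φ
  Sat ρ i (φ U ψ)       = ∃ λ j → i ≤ j × Sat ρ j ψ × (∀ k → i ≤ k → k < j → Sat ρ k φ)
  Sat ρ zero (X⁻¹ φ)    = ⊥
  Sat ρ (suc i) (X⁻¹ φ) = Sat ρ i φ
  Sat ρ i (φ S ψ)       = ∃ λ j → j ≤ i × Sat ρ j ψ × (∀ k → j < k → k ≤ i → Sat ρ k φ)

IterEquiv : ∀ {k} → ℕ → Vec ℕ k → Vec ℕ k → Set
IterEquiv α ns ns' = ∀ i → lookup ns i ⊓ α ≡ lookup ns' i ⊓ α

module Submission where

-- Satisfaction of a PLTL formula at the origin of a run only
-- depends on the ω-word of labels the run visits, and for a run respecting
-- P = p₁l₁⁺⋯p_kl_k^ω this is the label word of p₁l₁^{n₁}⋯p_kl_k^ω.  The core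
-- is a pumping lemma: inserting one more copy of a nonempty loop l into
-- u·lⁿ·r cannot change the truth of φ at 0 as soon as n ≥ 2·td(φ)+1.  It is
-- an Ehrenfeucht–Fraïssé argument in two layers:
--   * a graded simulation between two labelled ω-words (matching labels and
--     the moves of X, X⁻¹, U and S) preserves every formula of temporal
--     depth at most the grade (transfer, preserves);
--   * for the insertion, two positions are related at grade c if they are
--     equal and at least c·|l| before the end of the block lⁿ, or differ by
--     |l| and lie at least c·|l| after its start; while 2c+1 ≤ n these two
--     windows overlap, which gives such a simulation (module Insertion).
-- Iterating, iteration counts with the same truncation at α ≥ 2·td(φ)+1 give
-- equivalent words (module Pumping); changing the counts of the schema one
-- coordinate at a time proves the theorem (module Schema).

open import Defs
open import Data.Nat
  using (ℕ; zero; suc; _+_; _*_; _∸_; _⊓_; _≤_; _<_; z≤n; s≤s; _≤?_; _<?_)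
open import Data.Nat.Properties
open import Data.Nat.Tactic.RingSolver using (solve-∀)
open import Data.Bool using (Bool; true)
open import Data.Empty using (⊥; ⊥-elim)
import Data.Fin as Fin
open import Data.List using (List; []; _∷_; _++_; length; concat; replicate)
open import Data.List.Properties using (++-assoc; ++-identityʳ; length-++)
open import Data.Vec using (Vec; []; _∷_; lookup)
open import Data.Product using (∃; ∃₂; _×_; _,_; proj₂; swap)
import Data.Product as Product
open import Data.Sum using (_⊎_; inj₁; inj₂)
import Data.Sum as Sum
open import Function using (_∘_)
open import Function.Bundles using (_⇔_; mk⇔; Equivalence)
open import Function.Construct.Identity using (⇔-id)
open import Function.Construct.Symmetry using (⇔-sym)
open import Function.Construct.Composition using (_⇔-∘_)
open import Relation.Nullary using (yes; no)
open import Relation.Binary.PropositionalEquality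
  using (_≡_; refl; sym; trans; cong; subst; module ≡-Reasoning)

open Equivalence using (to; from)

infixr 5 _⨾_
_⨾_ : ∀ {A B C : Set} → A ⇔ B → B ⇔ C → A ⇔ C
A⇔B ⨾ B⇔C = B⇔C ⇔-∘ A⇔B

Labelling : Set → Set
Labelling AT = ℕ → AT → Bool

-- A graded relation between the positions of two words: R c i j says that
-- position i of the first and j of the second "look alike up to depth c".
GradedRel : Set₁
GradedRel = ℕ → ℕ → ℕ → Set

converse : GradedRel → GradedRel
converse R c j i = R c i j

split-above : ∀ {a k} L → a + L ≤ k → ∃ λ k₀ → k ≡ k₀ + L × a ≤ k₀
split-above {a} {k} L a+L≤k =
  k ∸ L , sym (m∸n+n≡m (≤-trans (m≤n+m L a) a+L≤k)) , m+n≤o⇒m≤o∸n a a+L≤k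

capped : ∀ {α m m'} → α ≤ m → m ⊓ α ≡ m' ⊓ α → α ≤ m'
capped {α} {m} {m'} α≤m same = begin
  α       ≡⟨ sym (m≥n⇒m⊓n≡n α≤m) ⟩
  m ⊓ α   ≡⟨ same ⟩
  m' ⊓ α  ≤⟨ m⊓n≤m m' α ⟩
  m'      ∎
  where open ≤-Reasoning

same-truncation : ∀ {α n n'} → n ⊓ α ≡ n' ⊓ α → n ≡ n' ⊎ (α ≤ n × α ≤ n')
same-truncation {α} {n} {n'} trunc with α ≤? n | α ≤? n'
... | yes α≤n | _        = inj₂ (α≤n , capped α≤n trunc)
... | no _    | yes α≤n' = inj₂ (capped α≤n' (sym trunc) , α≤n')
... | no n<α  | no n'<α  = inj₁ (begin
  n      ≡⟨ sym (m≤n⇒m⊓n≡m (<⇒≤ (≰⇒> n<α))) ⟩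
  n ⊓ α  ≡⟨ trunc ⟩
  n' ⊓ α ≡⟨ m≤n⇒m⊓n≡m (<⇒≤ (≰⇒> n'<α)) ⟩
  n'     ∎)
  where open ≡-Reasoning

module _ {AT : Set} where

  Holds : Labelling AT → ℕ → PLTL AT → Set
  Holds g i (atom a)      = g i a ≡ true
  Holds g i (¬' φ)        = Holds g i φ → ⊥
  Holds g i (φ ∧' ψ)      = Holds g i φ × Holds g i ψ
  Holds g i (X φ)         = Holds g (suc i) φ
  Holds g i (φ U ψ)       =
    ∃ λ j → i ≤ j × Holds g j ψ × (∀ k → i ≤ k → k < j → Holds g k φ)
  Holds g zero (X⁻¹ φ)    = ⊥
  Holds g (suc i) (X⁻¹ φ) = Holds g i φ
  Holds g i (φ S ψ)       =
    ∃ λ j → j ≤ i × Holds g j ψ × (∀ k → j < k → k ≤ i → Holds g k φ)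

  record Simulation (gA gB : Labelling AT) (R : GradedRel) : Set where
    field
      label : ∀ {c i j} → R c i j → gA i ≡ gB j
      next  : ∀ {c i j} → R (suc c) i j → R c (suc i) (suc j)
      prev  : ∀ {c i j} → R (suc c) i j →
              (i ≡ 0 × j ≡ 0) ⊎ ∃₂ λ i₀ j₀ → i ≡ suc i₀ × j ≡ suc j₀ × R c i₀ j₀
      until : ∀ {c i j i'} → R (suc c) i j → i ≤ i' →
              ∃ λ j' → j ≤ j' × R c i' j' ×
                (∀ k → j ≤ k → k < j' → ∃ λ k' → i ≤ k' × k' < i' × R c k' k)
      since : ∀ {c i j i'} → R (suc c) i j → i' ≤ i →
              ∃ λ j' → j' ≤ j × R c i' j' ×
                (∀ k → j' < k → k ≤ j → ∃ λ k' → i' < k' × k' ≤ i × R c k' k)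

  -- A simulation in both directions transfers truth of formulas of depth at
  -- most the grade; the converse simulation is what handles negation.
  transfer : ∀ {gA gB R} → Simulation gA gB R → Simulation gB gA (converse R) →
             ∀ φ {c i j} → td φ ≤ c → R c i j → Holds gA i φ → Holds gB j φ
  transfer sim sim' (atom a) _ r h = trans (cong (λ g → g a) (sym (Simulation.label sim r))) h
  transfer sim sim' (¬' φ) d r ¬h = λ h → ¬h (transfer sim' sim φ d r h)
  transfer sim sim' (φ ∧' ψ) d r (hφ , hψ) =
    transfer sim sim' φ (m⊔n≤o⇒m≤o (td φ) (td ψ) d) r hφ ,
    transfer sim sim' ψ (m⊔n≤o⇒n≤o (td φ) (td ψ) d) r hψ
  transfer sim sim' (X φ) (s≤s d) r h = transfer sim sim' φ d (Simulation.next sim r) h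
  transfer sim sim' (X⁻¹ φ) (s≤s d) r h with Simulation.prev sim r
  ... | inj₁ (refl , refl)                 = h
  ... | inj₂ (i₀ , j₀ , refl , refl , r₀) = transfer sim sim' φ d r₀ h
  transfer sim sim' (φ U ψ) (s≤s d) r (i' , i≤i' , hψ , hφ)
    with Simulation.until sim r i≤i'
  ... | j' , j≤j' , r' , matched =
    j' , j≤j' , transfer sim sim' ψ (m⊔n≤o⇒n≤o (td φ) (td ψ) d) r' hψ ,
    λ k j≤k k<j' → let (k' , i≤k' , k'<i' , rk) = matched k j≤k k<j'
                   in transfer sim sim' φ (m⊔n≤o⇒m≤o (td φ) (td ψ) d) rk
                                (hφ k' i≤k' k'<i')
  transfer sim sim' (φ S ψ) (s≤s d) r (i' , i'≤i , hψ , hφ)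
    with Simulation.since sim r i'≤i
  ... | j' , j'≤j , r' , matched =
    j' , j'≤j , transfer sim sim' ψ (m⊔n≤o⇒n≤o (td φ) (td ψ) d) r' hψ ,
    λ k j'<k k≤j → let (k' , i'<k' , k'≤i , rk) = matched k j'<k k≤j
                   in transfer sim sim' φ (m⊔n≤o⇒m≤o (td φ) (td ψ) d) rk
                                (hφ k' i'<k' k'≤i)

  preserves : ∀ {gA gB R} → Simulation gA gB R → Simulation gB gA (converse R) →
              ∀ φ {c i j} → td φ ≤ c → R c i j → Holds gA i φ ⇔ Holds gB j φ
  preserves sim sim' φ d r = mk⇔ (transfer sim sim' φ d r) (transfer sim' sim φ d r)

-- gB arises from gA by inserting L ≥ 1 positions somewhere in the block
-- [p, E) of gA whose labels are L-periodic: the words agree before E, and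
-- from p on gB is gA shifted by L.
module Insertion {AT : Set} (gA gB : Labelling AT) (p L E : ℕ) (L≥1 : 1 ≤ L)
                 (before : ∀ i → i < E → gA i ≡ gB i)
                 (after  : ∀ i → p ≤ i → gA i ≡ gB (i + L)) where

  Rel : ℕ → ℕ → ℕ → Set
  Rel m i j = (j ≡ i × i + m < E) ⊎ (j ≡ i + L × p + m ≤ i)

  -- The two windows of margin m still cover the whole word.
  Fits : ℕ → Set
  Fits m = p + m + m < E

  -- Grade c uses margin c·L, so that grade c+1 has margin L + c·L.
  record Corr (c i j : ℕ) : Set where
    constructor related
    field
      fits : Fits (c * L)
      rel  : Rel (c * L) i j

  -- The margins of grade c+1 leave an overlap of length L at grade c.
  room : ∀ {m} → Fits (L + m) → p + m + L + m ≤ E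
  room {m} fits = begin
    p + m + L + m       ≡⟨ regroup p m L ⟩
    p + (L + m) + m     ≤⟨ +-monoʳ-≤ (p + (L + m)) (m≤n+m m L) ⟩
    p + (L + m) + (L + m) <⟨ fits ⟩
    E                   ∎
    where
      open ≤-Reasoning
      regroup : ∀ p m L → p + m + L + m ≡ p + (L + m) + m
      regroup = solve-∀

  fits-down : ∀ {m} → Fits (L + m) → Fits m
  fits-down {m} = ≤-<-trans (+-mono-≤ (+-monoʳ-≤ p (m≤n+m m L)) (m≤n+m m L))

  late : ∀ {m k} → Fits (L + m) → E ≤ k + m → p + m + L ≤ k
  late {m} {k} fits E≤k+m = +-cancelʳ-≤ m (p + m + L) k (≤-trans (room fits) E≤k+m)

  early : ∀ {m k} → Fits (L + m) → k < p + m + L → k + m < E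
  early {m} fits k<p+m+L = <-≤-trans (+-monoˡ-< m k<p+m+L) (room fits)

  before-late : ∀ {m i k₀} → i + (L + m) < E → E ≤ k₀ + L + m → i < k₀
  before-late {m} {i} {k₀} i-early k-late =
    +-cancelʳ-< L i k₀ (+-cancelʳ-< m (i + L) (k₀ + L)
      (subst (_< k₀ + L + m) (sym (+-assoc i L m)) (<-≤-trans i-early k-late)))

  shift-down : ∀ {m i} → p + (L + m) ≤ i → p + m ≤ i
  shift-down {m} = ≤-trans (+-monoʳ-≤ p (m≤n+m m L))

  shift-strict : ∀ {m} → p + m < p + (L + m)
  shift-strict {m} = +-monoʳ-< p (+-monoˡ-< m L≥1)

  shift-start : ∀ {m i} → p + (L + m) ≤ i → p + m + L ≤ i
  shift-start {m} {i} = subst (_≤ i) (regroup p L m)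
    where
      regroup : ∀ p L m → p + (L + m) ≡ p + m + L
      regroup = solve-∀

  stay : ∀ {c k} → Fits (suc c * L) → k + c * L < E → Corr c k k
  stay fits k-early = related (fits-down fits) (inj₁ (refl , k-early))

  shift : ∀ {c k} → Fits (suc c * L) → p + c * L ≤ k → Corr c k (k + L)
  shift fits k-late = related (fits-down fits) (inj₂ (refl , k-late))

  -- The answers to the moves of a simulation: labels agree by the two
  -- hypotheses; X and X⁻¹ keep the mode (X⁻¹ from 0 is impossible in the
  -- shifted mode); U and S are answered in the same mode, or, when the move
  -- leaves its window, by switching modes inside the overlap of width L.
  label : ∀ {c i j} → Corr c i j → gA i ≡ gB j
  label {c} {i} (related _ (inj₁ (refl , i-early))) = before i (≤-<-trans (m≤m+n i (c * L)) i-early)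
  label {c} {i} (related _ (inj₂ (refl , i-late)))  = after i (≤-trans (m≤m+n p (c * L)) i-late)

  next : ∀ {c i j} → Corr (suc c) i j → Corr c (suc i) (suc j)
  next {c} {i} (related fits (inj₁ (refl , i-early))) = stay fits (≤-<-trans suc-early i-early)
    where
      suc-early : suc i + c * L ≤ i + (L + c * L)
      suc-early = subst (_≤ i + (L + c * L)) (+-suc i (c * L))
                        (+-monoʳ-≤ i (+-monoˡ-≤ (c * L) L≥1))
  next (related fits (inj₂ (refl , i-late))) = shift fits (≤-trans (shift-down i-late) (n≤1+n _))

  prev : ∀ {c i j} → Corr (suc c) i j →
         (i ≡ 0 × j ≡ 0) ⊎ ∃₂ λ i₀ j₀ → i ≡ suc i₀ × j ≡ suc j₀ × Corr c i₀ j₀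
  prev {i = zero} (related _ (inj₁ (refl , _))) = inj₁ (refl , refl)
  prev {c} {suc i₀} (related fits (inj₁ (refl , i-early))) =
    inj₂ (i₀ , i₀ , refl , refl ,
          stay fits (≤-<-trans (+-mono-≤ (n≤1+n i₀) (m≤n+m (c * L) L)) i-early))
  prev {i = zero} (related _ (inj₂ (refl , i-late))) =
    ⊥-elim (n≮0 (<-≤-trans shift-strict i-late))
  prev {i = suc i₀} (related fits (inj₂ (refl , i-late))) =
    inj₂ (i₀ , i₀ + L , refl , refl , shift fits (≤-pred (<-≤-trans shift-strict i-late)))

  until-AB : ∀ {c i j i'} → Corr (suc c) i j → i ≤ i' →
             ∃ λ j' → j ≤ j' × Corr c i' j' ×
               (∀ k → j ≤ k → k < j' → ∃ λ k' → i ≤ k' × k' < i' × Corr c k' k)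
  until-AB {c} {i} {i' = i'} (related fits (inj₂ (refl , i-late))) i≤i' =
    i' + L , +-monoˡ-≤ L i≤i' , shift fits (≤-trans (shift-down i-late) i≤i') , matched
    where
      matched : ∀ k → i + L ≤ k → k < i' + L → ∃ λ k' → i ≤ k' × k' < i' × Corr c k' k
      matched k i+L≤k k<i'+L with split-above L i+L≤k
      ... | k₀ , refl , i≤k₀ =
        k₀ , i≤k₀ , +-cancelʳ-< L k₀ i' k<i'+L , shift fits (≤-trans (shift-down i-late) i≤k₀)
  until-AB {c} {i} {i' = i'} (related fits (inj₁ (refl , i-early))) i≤i' with i' + c * L <? E
  ... | yes i'-early =
    i' , i≤i' , stay fits i'-early ,
    λ k i≤k k<i' → k , i≤k , k<i' , stay fits (<-trans (+-monoˡ-< (c * L) k<i') i'-early)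
  ... | no i'-late =
    i' + L , ≤-trans i≤i' (m≤m+n i' L) ,
    shift fits (≤-trans (m≤m+n _ L) (late fits (≮⇒≥ i'-late))) , matched
    where
      matched : ∀ k → i ≤ k → k < i' + L → ∃ λ k' → i ≤ k' × k' < i' × Corr c k' k
      matched k i≤k k<i'+L with k + c * L <? E
      ... | yes k-early =
        k , i≤k , +-cancelʳ-< (c * L) k i' (<-≤-trans k-early (≮⇒≥ i'-late)) , stay fits k-early
      ... | no k-late with split-above L (late fits (≮⇒≥ k-late))
      ... | k₀ , refl , k₀-late =
        k₀ , <⇒≤ (before-late i-early (≮⇒≥ k-late)) , +-cancelʳ-< L k₀ i' k<i'+L ,
        shift fits k₀-late

  until-BA : ∀ {c i j j'} → Corr (suc c) i j → j ≤ j' →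
             ∃ λ i' → i ≤ i' × Corr c i' j' ×
               (∀ k → i ≤ k → k < i' → ∃ λ k' → j ≤ k' × k' < j' × Corr c k k')
  until-BA {c} {i} (related fits (inj₂ (refl , i-late))) i+L≤j' with split-above L i+L≤j'
  ... | i₀ , refl , i≤i₀ =
    i₀ , i≤i₀ , shift fits (≤-trans (shift-down i-late) i≤i₀) ,
    λ k i≤k k<i₀ → k + L , +-monoˡ-≤ L i≤k , +-monoˡ-< L k<i₀ ,
                   shift fits (≤-trans (shift-down i-late) i≤k)
  until-BA {c} {i} {j' = j'} (related fits (inj₁ (refl , i-early))) i≤j' with j' + c * L <? E
  ... | yes j'-early =
    j' , i≤j' , stay fits j'-early ,
    λ k i≤k k<j' → k , i≤k , k<j' , stay fits (<-trans (+-monoˡ-< (c * L) k<j') j'-early)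
  ... | no j'-late with split-above L (late fits (≮⇒≥ j'-late))
  ... | i₀ , refl , i₀-late =
    i₀ , <⇒≤ (before-late i-early (≮⇒≥ j'-late)) , shift fits i₀-late , matched
    where
      matched : ∀ k → i ≤ k → k < i₀ → ∃ λ k' → i ≤ k' × k' < i₀ + L × Corr c k k'
      matched k i≤k k<i₀ with k + c * L <? E
      ... | yes k-early = k , i≤k , <-≤-trans k<i₀ (m≤m+n i₀ L) , stay fits k-early
      ... | no k-late =
        k + L , ≤-trans i≤k (m≤m+n k L) , +-monoˡ-< L k<i₀ ,
        shift fits (≤-trans (m≤m+n _ L) (late fits (≮⇒≥ k-late)))

  stay-below : ∀ {c i k} → Fits (suc c * L) → i + suc c * L < E → k ≤ i → Corr c k k
  stay-below {c} fits i-early k≤i =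
    stay fits (≤-<-trans (+-mono-≤ k≤i (m≤n+m (c * L) L)) i-early)

  since-AB : ∀ {c i j i'} → Corr (suc c) i j → i' ≤ i →
             ∃ λ j' → j' ≤ j × Corr c i' j' ×
               (∀ k → j' < k → k ≤ j → ∃ λ k' → i' < k' × k' ≤ i × Corr c k' k)
  since-AB {c} (related fits (inj₁ (refl , i-early))) i'≤i =
    _ , i'≤i , stay-below {c} fits i-early i'≤i ,
    λ k i'<k k≤i → k , i'<k , k≤i , stay-below {c} fits i-early k≤i
  since-AB {c} {i} {i' = i'} (related fits (inj₂ (refl , i-late))) i'≤i with p + c * L ≤? i'
  ... | yes i'-late = i' + L , +-monoˡ-≤ L i'≤i , shift fits i'-late , matched
    where
      matched : ∀ k → i' + L < k → k ≤ i + L → ∃ λ k' → i' < k' × k' ≤ i × Corr c k' k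
      matched k i'+L<k k≤i+L with split-above L (<⇒≤ i'+L<k)
      ... | k₀ , refl , _ =
        k₀ , i'<k₀ , +-cancelʳ-≤ L k₀ i k≤i+L , shift fits (≤-trans i'-late (<⇒≤ i'<k₀))
        where
          i'<k₀ : i' < k₀
          i'<k₀ = +-cancelʳ-< L i' k₀ i'+L<k
  ... | no i'-early =
    i' , ≤-trans i'≤i (m≤m+n i L) ,
    stay fits (early fits (<-≤-trans (≰⇒> i'-early) (m≤m+n _ L))) , matched
    where
      matched : ∀ k → i' < k → k ≤ i + L → ∃ λ k' → i' < k' × k' ≤ i × Corr c k' k
      matched k i'<k k≤i+L with k <? p + c * L + L
      ... | yes k-early =
        k , i'<k , <⇒≤ (<-≤-trans k-early (shift-start i-late)) , stay fits (early fits k-early)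
      ... | no k-late with split-above L (≮⇒≥ k-late)
      ... | k₀ , refl , k₀-late =
        k₀ , <-≤-trans (≰⇒> i'-early) k₀-late , +-cancelʳ-≤ L k₀ i k≤i+L , shift fits k₀-late

  since-BA : ∀ {c i j j'} → Corr (suc c) i j → j' ≤ j →
             ∃ λ i' → i' ≤ i × Corr c i' j' ×
               (∀ k → i' < k → k ≤ i → ∃ λ k' → j' < k' × k' ≤ j × Corr c k k')
  since-BA {c} (related fits (inj₁ (refl , i-early))) j'≤i =
    _ , j'≤i , stay-below {c} fits i-early j'≤i ,
    λ k j'<k k≤i → k , j'<k , k≤i , stay-below {c} fits i-early k≤i
  since-BA {c} {i} {j' = j'} (related fits (inj₂ (refl , i-late))) j'≤i+L with p + c * L + L ≤? j'
  ... | yes j'-late with split-above L j'-late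
  ... | i₀ , refl , i₀-late =
    i₀ , +-cancelʳ-≤ L i₀ i j'≤i+L , shift fits i₀-late ,
    λ k i₀<k k≤i → k + L , +-monoˡ-< L i₀<k , +-monoˡ-≤ L k≤i ,
                   shift fits (≤-trans i₀-late (<⇒≤ i₀<k))
  since-BA {c} {i} {j' = j'} (related fits (inj₂ (refl , i-late))) j'≤i+L | no j'-early =
    j' , <⇒≤ (<-≤-trans (≰⇒> j'-early) (shift-start i-late)) ,
    stay fits (early fits (≰⇒> j'-early)) , matched
    where
      matched : ∀ k → j' < k → k ≤ i → ∃ λ k' → j' < k' × k' ≤ i + L × Corr c k k'
      matched k j'<k k≤i with p + c * L ≤? k
      ... | yes k-late = k + L , <-≤-trans j'<k (m≤m+n k L) , +-monoˡ-≤ L k≤i , shift fits k-late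
      ... | no k-early =
        k , j'<k , ≤-trans k≤i (m≤m+n i L) ,
        stay fits (early fits (<-≤-trans (≰⇒> k-early) (m≤m+n _ L)))

  forth : Simulation gA gB Corr
  forth = record
    { label = label ; next = next ; prev = prev ; until = until-AB ; since = since-AB }

  back : Simulation gB gA (converse Corr)
  back = record
    { label = sym ∘ label
    ; next  = next
    ; prev  = Sum.map swap (λ (i₀ , j₀ , i≡ , j≡ , r) → j₀ , i₀ , j≡ , i≡ , r) ∘ prev
    ; until = until-BA
    ; since = since-BA
    }

  insertion-preserves : ∀ φ → Fits (td φ * L) → Holds gA 0 φ ⇔ Holds gB 0 φ
  insertion-preserves φ fits =
    preserves forth back φ ≤-refl (related fits (inj₁ (refl , origin-early)))
    where
      origin-early : td φ * L < E
      origin-early = ≤-<-trans (≤-trans (m≤n+m _ p) (m≤m+n _ _)) fits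

module Words {A : Set} where

  rep : ℕ → List A → List A
  rep n l = concat (replicate n l)

  length-rep : ∀ n l → length (rep n l) ≡ n * length l
  length-rep zero    l = refl
  length-rep (suc n) l = trans (length-++ l) (cong (length l +_) (length-rep n l))

  rep-comm : ∀ n l → rep n l ++ l ≡ l ++ rep n l
  rep-comm zero    l = sym (++-identityʳ l)
  rep-comm (suc n) l = trans (++-assoc l (rep n l) l) (cong (l ++_) (rep-comm n l))

  ++ω-drop : ∀ xs ys (f : ℕ → A) t → ((xs ++ ys) ++ω f) (length xs + t) ≡ (ys ++ω f) t
  ++ω-drop []       ys f t = refl
  ++ω-drop (x ∷ xs) ys f t = ++ω-drop xs ys f t

  ++ω-take : ∀ xs ys zs (f g : ℕ → A) j → j < length xs →
             ((xs ++ ys) ++ω f) j ≡ ((xs ++ zs) ++ω g) j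
  ++ω-take (x ∷ xs) ys zs f g zero    _         = refl
  ++ω-take (x ∷ xs) ys zs f g (suc j) (s≤s j<n) = ++ω-take xs ys zs f g j j<n

module Pumping {A AT : Set} (lbl : A → AT → Bool) where
  open Words

  word-labels : List A → (ℕ → A) → Labelling AT
  word-labels xs f i = lbl ((xs ++ω f) i)

  relist : ∀ {xs ys} f φ → xs ≡ ys →
           Holds (word-labels xs f) 0 φ ⇔ Holds (word-labels ys f) 0 φ
  relist f φ refl = ⇔-id _

  pumped : List A → List A → List A → (ℕ → A) → ℕ → Labelling AT
  pumped u l r f n = word-labels ((u ++ rep n l) ++ r) f

  -- The windows of depth c fit into u·lⁿ when 2c+1 ≤ n.
  fits-bound : ∀ {p c n L} → 1 ≤ L → 2 * c + 1 ≤ n → p + c * L + c * L < p + n * L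
  fits-bound {p} {c} {n} {L} L≥1 bound = begin-strict
    p + c * L + c * L       <⟨ m<m+n _ L≥1 ⟩
    p + c * L + c * L + L   ≡⟨ regroup p c L ⟩
    p + (2 * c + 1) * L     ≤⟨ +-monoʳ-≤ p (*-monoˡ-≤ L bound) ⟩
    p + n * L               ∎
    where
      open ≤-Reasoning
      regroup : ∀ p c L → p + c * L + c * L + L ≡ p + (2 * c + 1) * L
      regroup = solve-∀

  pump-once : ∀ u l r f n φ → 1 ≤ length l → 2 * td φ + 1 ≤ n →
              Holds (pumped u l r f n) 0 φ ⇔ Holds (pumped u l r f (suc n)) 0 φ
  pump-once u l r f n φ L≥1 bound =
    Insertion.insertion-preserves (pumped u l r f n) (pumped u l r f (suc n))
      (length u) (length l) (length u + n * length l) L≥1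
      (λ i i<E → cong lbl (agree-before i i<E)) (λ i u≤i → cong lbl (agree-after i u≤i))
      φ (fits-bound {c = td φ} L≥1 bound)
    where
      open ≡-Reasoning
      x : List A
      x = rep n l
      at : ∀ {xs ys} i → xs ≡ ys → (xs ++ω f) i ≡ (ys ++ω f) i
      at i xs≡ys = cong (λ zs → (zs ++ω f) i) xs≡ys

      agree-before : ∀ i → i < length u + n * length l →
                     (((u ++ x) ++ r) ++ω f) i ≡ (((u ++ (l ++ x)) ++ r) ++ω f) i
      agree-before i i<E = trans
        (++ω-take (u ++ x) r (l ++ r) f f i
          (subst (i <_) (sym (trans (length-++ u) (cong (length u +_) (length-rep n l)))) i<E))
        (at i (begin
          (u ++ x) ++ l ++ r   ≡⟨ ++-assoc u x (l ++ r) ⟩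
          u ++ x ++ l ++ r     ≡⟨ cong (u ++_) (sym (++-assoc x l r)) ⟩
          u ++ (x ++ l) ++ r   ≡⟨ cong (λ y → u ++ y ++ r) (rep-comm n l) ⟩
          u ++ (l ++ x) ++ r   ≡⟨ sym (++-assoc u (l ++ x) r) ⟩
          (u ++ (l ++ x)) ++ r ∎))

      agree-after : ∀ i → length u ≤ i →
                    (((u ++ x) ++ r) ++ω f) i ≡ (((u ++ (l ++ x)) ++ r) ++ω f) (i + length l)
      agree-after i u≤i with m≤n⇒∃[o]m+o≡n u≤i
      ... | t , refl = begin
        (((u ++ x) ++ r) ++ω f) (length u + t)
          ≡⟨ at _ (++-assoc u x r) ⟩
        ((u ++ x ++ r) ++ω f) (length u + t)
          ≡⟨ ++ω-drop u (x ++ r) f t ⟩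
        ((x ++ r) ++ω f) t
          ≡⟨ sym (++ω-drop l (x ++ r) f t) ⟩
        ((l ++ x ++ r) ++ω f) (length l + t)
          ≡⟨ sym (++ω-drop u (l ++ x ++ r) f (length l + t)) ⟩
        ((u ++ l ++ x ++ r) ++ω f) (length u + (length l + t))
          ≡⟨ at _ (sym (trans (++-assoc u (l ++ x) r) (cong (u ++_) (++-assoc l x r)))) ⟩
        (((u ++ (l ++ x)) ++ r) ++ω f) (length u + (length l + t))
          ≡⟨ cong (((u ++ (l ++ x)) ++ r) ++ω f) (regroup (length u) (length l) t) ⟩
        (((u ++ (l ++ x)) ++ r) ++ω f) (length u + t + length l) ∎
        where
          regroup : ∀ a b t → a + (b + t) ≡ a + t + b
          regroup = solve-∀

  pump-many : ∀ u l r f n φ → 1 ≤ length l → 2 * td φ + 1 ≤ n → ∀ d →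
              Holds (pumped u l r f n) 0 φ ⇔ Holds (pumped u l r f (d + n)) 0 φ
  pump-many u l r f n φ L≥1 bound zero    = ⇔-id _
  pump-many u l r f n φ L≥1 bound (suc d) =
    pump-many u l r f n φ L≥1 bound d ⨾ pump-once u l r f (d + n) φ L≥1 (≤-trans bound (m≤n+m n d))

  pump-up : ∀ u l r f φ {n n'} → 1 ≤ length l → 2 * td φ + 1 ≤ n → n ≤ n' →
            Holds (pumped u l r f n) 0 φ ⇔ Holds (pumped u l r f n') 0 φ
  pump-up u l r f φ {n} L≥1 bound n≤n' with m≤n⇒∃[o]m+o≡n n≤n'
  ... | d , refl rewrite +-comm n d = pump-many u l r f n φ L≥1 bound d

  pump-truncated : ∀ u l r f φ {α n n'} → 1 ≤ length l → 2 * td φ + 1 ≤ α →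
                   n ⊓ α ≡ n' ⊓ α →
                   Holds (pumped u l r f n) 0 φ ⇔ Holds (pumped u l r f n') 0 φ
  pump-truncated u l r f φ {α} {n} {n'} L≥1 bound trunc with same-truncation trunc
  ... | inj₁ refl = ⇔-id _
  ... | inj₂ (α≤n , α≤n') with ≤-total n n'
  ...   | inj₁ n≤n' = pump-up u l r f φ L≥1 (≤-trans bound α≤n) n≤n'
  ...   | inj₂ n'≤n = ⇔-sym (pump-up u l r f φ L≥1 (≤-trans bound α≤n') n'≤n)

module Schema {AT : Set} (Sys : CounterSystem AT) where
  open CounterSystem Sys using (lab)
  open Words using (rep)
  open Pumping (λ t → lab (srcT Sys t))

  private
    Word : Set
    Word = List (Tr Sys)

  regroup : ∀ (u p x r q : Word) → u ++ (p ++ x ++ r) ++ q ≡ ((u ++ p) ++ x) ++ r ++ q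
  regroup u p x r q = begin
    u ++ (p ++ x ++ r) ++ q   ≡⟨ cong (u ++_) (++-assoc p (x ++ r) q) ⟩
    u ++ p ++ (x ++ r) ++ q   ≡⟨ cong (λ y → u ++ p ++ y) (++-assoc x r q) ⟩
    u ++ p ++ x ++ r ++ q     ≡⟨ sym (++-assoc u p (x ++ r ++ q)) ⟩
    (u ++ p) ++ x ++ r ++ q   ≡⟨ sym (++-assoc (u ++ p) x (r ++ q)) ⟩
    ((u ++ p) ++ x) ++ r ++ q ∎
    where open ≡-Reasoning

  iterations-preserve :
    ∀ φ {α} → 2 * td φ + 1 ≤ α →
    ∀ {k} (segs : Vec (Word × Word) k) → (∀ i → 1 ≤ length (proj₂ (lookup segs i))) →
    ∀ u q f {ns ns' : Vec ℕ k} → IterEquiv α ns ns' →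
    Holds (word-labels (u ++ iterWord Sys segs ns ++ q) f) 0 φ ⇔
    Holds (word-labels (u ++ iterWord Sys segs ns' ++ q) f) 0 φ
  iterations-preserve φ bound [] _ u q f {[]} {[]} _ = ⇔-id _
  iterations-preserve φ bound ((p , l) ∷ segs) nonempty u q f {n ∷ ns} {n' ∷ ns'} equiv =
    relist f φ (regroup u p (rep n l) (iterWord Sys segs ns) q)
    ⨾ pump-truncated (u ++ p) l (iterWord Sys segs ns ++ q) f φ
        (nonempty Fin.zero) bound (equiv Fin.zero)
    ⨾ iterations-preserve φ bound segs (nonempty ∘ Fin.suc)
        ((u ++ p) ++ rep n' l) q f (equiv ∘ Fin.suc)
    ⨾ relist f φ (sym (regroup u p (rep n' l) (iterWord Sys segs ns') q))

  loop-nonempty : ∀ {l} → Loop Sys l → 1 ≤ length l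
  loop-nonempty {_ ∷ _} _ = s≤s z≤n

  sat⇔holds : ∀ (ρ : Run Sys) (g : Labelling AT) → (∀ i → lab (Run.st ρ i) ≡ g i) →
              ∀ φ i → Sat Sys ρ i φ ⇔ Holds g i φ
  sat⇔holds ρ g same (atom a) i =
    mk⇔ (trans (cong (λ h → h a) (sym (same i)))) (trans (cong (λ h → h a) (same i)))
  sat⇔holds ρ g same (¬' φ) i =
    mk⇔ (λ ¬s h → ¬s (from ih h)) (λ ¬h s → ¬h (to ih s))
    where
      ih : Sat Sys ρ i φ ⇔ Holds g i φ
      ih = sat⇔holds ρ g same φ i
  sat⇔holds ρ g same (φ ∧' ψ) i =
    mk⇔ (Product.map (to ihφ) (to ihψ)) (Product.map (from ihφ) (from ihψ))
    where
      ihφ : Sat Sys ρ i φ ⇔ Holds g i φ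
      ihφ = sat⇔holds ρ g same φ i
      ihψ : Sat Sys ρ i ψ ⇔ Holds g i ψ
      ihψ = sat⇔holds ρ g same ψ i
  sat⇔holds ρ g same (X φ) i = sat⇔holds ρ g same φ (suc i)
  sat⇔holds ρ g same (φ U ψ) i =
    mk⇔ (λ (j , i≤j , hψ , hφ) →
           j , i≤j , to (ihψ j) hψ , λ k i≤k k<j → to (ihφ k) (hφ k i≤k k<j))
        (λ (j , i≤j , hψ , hφ) →
           j , i≤j , from (ihψ j) hψ , λ k i≤k k<j → from (ihφ k) (hφ k i≤k k<j))
    where
      ihφ : ∀ k → Sat Sys ρ k φ ⇔ Holds g k φ
      ihφ = sat⇔holds ρ g same φ
      ihψ : ∀ k → Sat Sys ρ k ψ ⇔ Holds g k ψ
      ihψ = sat⇔holds ρ g same ψ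
  sat⇔holds ρ g same (X⁻¹ φ) zero    = ⇔-id ⊥
  sat⇔holds ρ g same (X⁻¹ φ) (suc i) = sat⇔holds ρ g same φ i
  sat⇔holds ρ g same (φ S ψ) i =
    mk⇔ (λ (j , j≤i , hψ , hφ) →
           j , j≤i , to (ihψ j) hψ , λ k j<k k≤i → to (ihφ k) (hφ k j<k k≤i))
        (λ (j , j≤i , hψ , hφ) →
           j , j≤i , from (ihψ j) hψ , λ k j<k k≤i → from (ihφ k) (hφ k j<k k≤i))
    where
      ihφ : ∀ k → Sat Sys ρ k φ ⇔ Holds g k φ
      ihφ = sat⇔holds ρ g same φ
      ihψ : ∀ k → Sat Sys ρ k ψ ⇔ Holds g k ψ
      ihψ = sat⇔holds ρ g same ψ

  run-word : ∀ (P : PathSchema Sys) (ρ : Run Sys) {ns} → Respects Sys P ρ ns → ∀ φ →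
             Sat Sys ρ 0 φ ⇔
             Holds (word-labels (iterWord Sys (PathSchema.segs P) ns ++ PathSchema.pk P)
                      (cycleω (PathSchema.lkHead P) (PathSchema.lkTail P))) 0 φ
  run-word P ρ (_ , follows) φ = sat⇔holds ρ _
    (λ i → cong lab (trans (sym (Run.src-ok ρ i)) (cong (srcT Sys) (follows i)))) φ 0

-- Pass from ρ to its schema word, change the iteration counts (the bound
-- 2·td(φ)+5 exceeds the needed 2·td(φ)+1), and return to ρ'.
proposition1 : {AT : Set} (Sys : CounterSystem AT) → Flat Sys →
    (P : PathSchema Sys) (φ : PLTL AT) (ρ ρ' : Run Sys)
    (ns ns' : Vec ℕ (PathSchema.k' P)) →
    Respects Sys P ρ ns → Respects Sys P ρ' ns' →
    IterEquiv (2 * td φ + 5) ns ns' →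
    (Sat Sys ρ 0 φ → Sat Sys ρ' 0 φ) × (Sat Sys ρ' 0 φ → Sat Sys ρ 0 φ)
proposition1 Sys _ P φ ρ ρ' ns ns' respects respects' equiv = to same-truth , from same-truth
  where
    open Schema Sys
    same-truth : Sat Sys ρ 0 φ ⇔ Sat Sys ρ' 0 φ
    same-truth =
      run-word P ρ respects φ
      ⨾ iterations-preserve φ (+-monoʳ-≤ (2 * td φ) (s≤s z≤n))
          (PathSchema.segs P) (loop-nonempty ∘ PathSchema.segLoops P)
          [] (PathSchema.pk P) _ equiv
      ⨾ ⇔-sym (run-word P ρ' respects' φ)
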